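{- Let $\widehat{G}$ be a signed bigraph with bipartition $(X,Y)$ whose underlying graph is non-separable and has no isolated vertices, and let $x_1,\dots,x_\alpha,y_1,\dots,y_\beta$ be a canonical ordering of $\widehat{G}$. Suppose that there are distinct $x_i,x_j,x_k\in X$ and distinct $y_\ell,y_q,y_r\in Y$ with $x_i,x_j\in N(y_1)$ such that the subgraph induced by $\{x_i,x_j,x_k,y_\ell,y_q,y_r\}$ has exactly the edges $x_iy_\ell,x_iy_q,x_iy_r,x_jy_\ell,x_jy_q,x_jy_r,x_ky_r$, where $x_iy_\ell$, $x_iy_q$ and $x_jy_r$ are negative (the other four of arbitrary sign). If no edge of $\widehat{G}$ is signed simplicial, then $\widehat{G}$ contains a signed graph in $F_3\cup F_4\cup F_5\cup F_6$ as an induced subgraph.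
   Context: A signed graph is a finite simple graph with each edge assigned a sign, positive or negative; induced subgraphs inherit signs; containment is up to sign-preserving isomorphism. A signed bigraph has bipartite underlying graph. A bigraph is separable if it contains an induced $2K_2$, non-separable otherwise. A canonical ordering of a non-separable bigraph with bipartition $(X,Y)$ is an ordering $x_1,\dots,x_\alpha$ of $X$ and $y_1,\dots,y_\beta$ of $Y$ with $N(x_1)\supseteq\cdots\supseteq N(x_\alpha)$ and $N(y_1)\subseteq\cdots\subseteq N(y_\beta)$. A subgraph $H$ is a biclique if every vertex of $V(H)\cap X$ is adjacent to every vertex of $V(H)\cap Y$; positive if all edges positive. For an edge $uv$, $N(uv)=(N(u)\cup N(v))\setminus\{u,v\}$; $uv$ is signed simplicial if $N(uv)$ induces a positive biclique. "Arbitrary" signs mean all choices are included. $F_3$: $K_{2,4}$ with parts $\{a,b\},\{p,q,r,s\}$; $ap,aq,br,bs$ negative; $bp,bq,ar,as$ arbitrary. $F_4$: $K_{3,3}$ with parts $\{a,b,c\},\{p,q,r\}$; $ap,bq,cr$ negative; other six edges arbitrary. $F_5$: parts $\{a,b,c\},\{p,q,r\}$, all nine cross pairs edges except $ar$; $bp,cq$ negative; $ap,aq,bq,br,cp,cr$ arbitrary. $F_6$: parts $\{a,b,c,d\},\{p,q,r,s\}$, edges exactly $pa,pb,pc,pd,qa,qb,qc,qd,rc,rd,sc,sd$; $ap,bp,cq,dr,ds$ negative; $aq,bq,cp,dp,dq,cr,cs$ arbitrary. -}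

module Defs where

open import Data.Nat using (ℕ; zero; suc; _<_; _≤_)
open import Data.Fin using (Fin; zero; suc; _≟_; fromℕ<; #_) renaming (_≤_ to _≤ᶠ_)
open import Data.Maybe using (Maybe; just; nothing)
open import Data.Product using (Σ; ∃; _×_; _,_)
open import Data.Sum using (_⊎_)
open import Data.List using (List; []; _∷_)
open import Data.Vec using (Vec; lookup; []; _∷_)
open import Relation.Nullary using (¬_; yes; no)
open import Relation.Binary.PropositionalEquality using (_≡_; _≢_)
open import Function.Definitions using (Injective)


data Sign : Set where
  pos neg : Sign

record SignedGraph (n : ℕ) : Set where
  field
    e         : Fin n → Fin n → Maybe Sign
    symmetric : ∀ u v → e u v ≡ e v u
    loopless  : ∀ v → e v v ≡ nothing
open SignedGraph public

Adj : ∀ {n} → SignedGraph n → Fin n → Fin n → Set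
Adj G u v = ∃ λ s → e G u v ≡ just s

PositiveEdge : ∀ {n} → SignedGraph n → Fin n → Fin n → Set
PositiveEdge G u v = e G u v ≡ just pos

data Side : Set where
  X Y : Side

record SignedBigraph (n : ℕ) : Set where
  field
    graph     : SignedGraph n
    side      : Fin n → Side
    bipartite : ∀ u v → Adj graph u v → side u ≢ side v
open SignedBigraph public

HasInduced2K2 : ∀ {n} → SignedGraph n → Set
HasInduced2K2 {n} G = Σ (Fin n) λ a → Σ (Fin n) λ b → Σ (Fin n) λ c → Σ (Fin n) λ d →
  a ≢ b × a ≢ c × a ≢ d × b ≢ c × b ≢ d × c ≢ d ×
  Adj G a b × Adj G c d ×
  ¬ Adj G a c × ¬ Adj G a d × ¬ Adj G b c × ¬ Adj G b d

Separable NonSeparable : ∀ {n} → SignedGraph n → Set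
Separable G = HasInduced2K2 G
NonSeparable G = ¬ Separable G

NoIsolatedVertices : ∀ {n} → SignedGraph n → Set
NoIsolatedVertices {n} G = ∀ v → Σ (Fin n) λ w → Adj G v w

Enumerates : ∀ {n m} → SignedBigraph n → Side → (Fin m → Fin n) → Set
Enumerates {n} {m} B s o =
  Injective _≡_ _≡_ o × (∀ i → side B (o i) ≡ s) ×
  (∀ v → side B v ≡ s → Σ (Fin m) λ i → o i ≡ v)

CanonicalOrdering : ∀ {n α β} → SignedBigraph n → (Fin α → Fin n) → (Fin β → Fin n) → Set
CanonicalOrdering {n} B ox oy =
  Enumerates B X ox × Enumerates B Y oy ×
  (∀ i j → i ≤ᶠ j → ∀ w → Adj (graph B) (ox j) w → Adj (graph B) (ox i) w) ×
  (∀ i j → i ≤ᶠ j → ∀ w → Adj (graph B) (oy i) w → Adj (graph B) (oy j) w)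

InN2 : ∀ {n} → SignedGraph n → Fin n → Fin n → Fin n → Set
InN2 G u v w = (Adj G u w ⊎ Adj G v w) × w ≢ u × w ≢ v

SignedSimplicial : ∀ {n} → SignedBigraph n → Fin n → Fin n → Set
SignedSimplicial B u v =
  (∀ w z → InN2 (graph B) u v w → InN2 (graph B) u v z →
     side B w ≡ X → side B z ≡ Y → Adj (graph B) w z) ×
  (∀ w z → InN2 (graph B) u v w → InN2 (graph B) u v z →
     Adj (graph B) w z → PositiveEdge (graph B) w z)

data Pat : Set where
  nonEdge negEdge anyEdge : Pat

Match : Pat → Maybe Sign → Set
Match nonEdge x = x ≡ nothing
Match negEdge x = x ≡ just neg
Match anyEdge x = ∃ λ s → x ≡ just s

record PEdge (k : ℕ) : Set where
  constructor _─_∶_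
  field
    src tgt : Fin k
    pat     : Pat

-- symmetric lookup in a list of edges; pairs not listed are non-edges
patOf : ∀ {k} → List (PEdge k) → Fin k → Fin k → Pat
patOf [] u v = nonEdge
patOf ((a ─ b ∶ p) ∷ es) u v with a ≟ u | b ≟ v | a ≟ v | b ≟ u
... | yes _ | yes _ | _     | _     = p
... | _     | _     | yes _ | yes _ = p
... | _     | _     | _     | _     = patOf es u v

InducesPattern : ∀ {n k} → SignedGraph n → List (PEdge k) → (Fin k → Fin n) → Set
InducesPattern G es g = Injective _≡_ _≡_ g × (∀ u v → Match (patOf es u v) (e G (g u) (g v)))

-- F3 : a b | p q r s  =  0 1 | 2 3 4 5
F3pat : List (PEdge 6)
F3pat =
  ((# 0) ─ (# 2) ∶ negEdge) ∷ ((# 0) ─ (# 3) ∶ negEdge) ∷ ((# 1) ─ (# 4) ∶ negEdge) ∷ ((# 1) ─ (# 5) ∶ negEdge) ∷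
  ((# 1) ─ (# 2) ∶ anyEdge) ∷ ((# 1) ─ (# 3) ∶ anyEdge) ∷ ((# 0) ─ (# 4) ∶ anyEdge) ∷ ((# 0) ─ (# 5) ∶ anyEdge) ∷ []

-- F4 : a b c | p q r  =  0 1 2 | 3 4 5
F4pat : List (PEdge 6)
F4pat =
  ((# 0) ─ (# 3) ∶ negEdge) ∷ ((# 1) ─ (# 4) ∶ negEdge) ∷ ((# 2) ─ (# 5) ∶ negEdge) ∷
  ((# 0) ─ (# 4) ∶ anyEdge) ∷ ((# 0) ─ (# 5) ∶ anyEdge) ∷ ((# 1) ─ (# 3) ∶ anyEdge) ∷
  ((# 1) ─ (# 5) ∶ anyEdge) ∷ ((# 2) ─ (# 3) ∶ anyEdge) ∷ ((# 2) ─ (# 4) ∶ anyEdge) ∷ []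

-- F5 : a b c | p q r  =  0 1 2 | 3 4 5 ; all cross pairs except ar
F5pat : List (PEdge 6)
F5pat =
  ((# 1) ─ (# 3) ∶ negEdge) ∷ ((# 2) ─ (# 4) ∶ negEdge) ∷
  ((# 0) ─ (# 3) ∶ anyEdge) ∷ ((# 0) ─ (# 4) ∶ anyEdge) ∷ ((# 1) ─ (# 4) ∶ anyEdge) ∷
  ((# 1) ─ (# 5) ∶ anyEdge) ∷ ((# 2) ─ (# 3) ∶ anyEdge) ∷ ((# 2) ─ (# 5) ∶ anyEdge) ∷ []

-- F6 : a b c d | p q r s  =  0 1 2 3 | 4 5 6 7
-- edges pa pb pc pd qa qb qc qd rc rd sc sd
F6pat : List (PEdge 8)
F6pat =
  ((# 0) ─ (# 4) ∶ negEdge) ∷ ((# 1) ─ (# 4) ∶ negEdge) ∷ ((# 2) ─ (# 5) ∶ negEdge) ∷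
  ((# 3) ─ (# 6) ∶ negEdge) ∷ ((# 3) ─ (# 7) ∶ negEdge) ∷
  ((# 0) ─ (# 5) ∶ anyEdge) ∷ ((# 1) ─ (# 5) ∶ anyEdge) ∷ ((# 2) ─ (# 4) ∶ anyEdge) ∷ ((# 3) ─ (# 4) ∶ anyEdge) ∷
  ((# 3) ─ (# 5) ∶ anyEdge) ∷ ((# 2) ─ (# 6) ∶ anyEdge) ∷ ((# 2) ─ (# 7) ∶ anyEdge) ∷ []

ContainsF3456 : ∀ {n} → SignedGraph n → Set
ContainsF3456 {n} G =
  (Σ (Fin 6 → Fin n) λ g → InducesPattern G F3pat g) ⊎
  (Σ (Fin 6 → Fin n) λ g → InducesPattern G F4pat g) ⊎
  (Σ (Fin 6 → Fin n) λ g → InducesPattern G F5pat g) ⊎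
  (Σ (Fin 8 → Fin n) λ g → InducesPattern G F6pat g)

-- The configuration in the hypothesis:
-- x_i x_j x_k | y_ℓ y_q y_r  =  0 1 2 | 3 4 5
-- edges exactly x_iy_ℓ x_iy_q x_iy_r x_jy_ℓ x_jy_q x_jy_r x_ky_r,
-- with x_iy_ℓ , x_iy_q , x_jy_r negative
ConfigPat : List (PEdge 6)
ConfigPat =
  ((# 0) ─ (# 3) ∶ negEdge) ∷ ((# 0) ─ (# 4) ∶ negEdge) ∷ ((# 1) ─ (# 5) ∶ negEdge) ∷
  ((# 0) ─ (# 5) ∶ anyEdge) ∷ ((# 1) ─ (# 3) ∶ anyEdge) ∷ ((# 1) ─ (# 4) ∶ anyEdge) ∷ ((# 2) ─ (# 5) ∶ anyEdge) ∷ []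

six : ∀ {n} → (xi xj xk yl yq yr : Fin n) → Fin 6 → Fin n
six xi xj xk yl yq yr i = lookup (xi ∷ xj ∷ xk ∷ yl ∷ yq ∷ yr ∷ []) i

-- Let x_s be the last neighbour of y_r in the canonical ordering, so that N(x_s) ⊆ N(w) for
-- every neighbour w of y_r; as x_k is such a neighbour, x_s misses y_ℓ and y_q. Whenever u ∈ N(y_r)
-- has N(u) ⊆ N(x_s), the set N(u y_r) induces a biclique, so u y_r can only fail to be signed
-- simplicial through a negative edge x y with x ∈ N(y_r) and y ∈ N(u) ⊆ N(x_s). Since x_i and x_j
-- see y_1, they see all of Y, and such an edge yields F3 if x = x_j, F5 if x = x_i, and F4 if x
-- sees y_ℓ or y_q. Otherwise x lies outside the configuration. Take u = x_s to get x′ y′. A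
-- neighbour of x′ outside N(x_s) yields F5; otherwise take u = x′ to get x″ y″, which yields F6
-- if y″ = y′ and F4 if not.

module Submission where

open import Defs
open import Data.Nat using (ℕ; _+_; _<_; z≤n; s≤s)
import Data.Nat as ℕ
open import Data.Fin using (Fin; zero; suc; toℕ; fromℕ<; _↑ˡ_; _↑ʳ_) renaming (_≟_ to _≟ᶠ_; _≤_ to _≤ᶠ_)
open import Data.Fin.Patterns using (0F; 1F; 2F; 3F; 4F; 5F)
open import Data.Fin.Properties using (all?; any?; toℕ-fromℕ<)
open import Data.Maybe using (just; nothing)
open import Data.Product using (Σ; ∃; _×_; _,_; proj₁; proj₂)
open import Data.Sum using (_⊎_; inj₁; inj₂; [_,_]′)
open import Data.Empty using (⊥-elim)
open import Data.List using (List; []; _∷_)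
open import Data.Vec using (Vec; lookup; _++_; []; _∷_)
open import Data.Vec.Properties using (lookup-++ˡ; lookup-++ʳ)
open import Data.Vec.Relation.Unary.All using (All; []; _∷_)
open import Data.Vec.Relation.Unary.All.Properties using (lookup⁺)
open import Data.Vec.Relation.Unary.AllPairs using ([]; _∷_)
open import Data.Vec.Relation.Unary.Unique.Propositional using (Unique)
open import Data.Vec.Relation.Unary.Unique.Propositional.Properties using (lookup-injective)
open import Relation.Nullary using (¬_; Dec; yes; no; ¬?)
open import Relation.Nullary.Decidable using (_×-dec_; _⊎-dec_; from-yes; map′)
open import Relation.Binary.PropositionalEquality using (_≡_; _≢_; refl; sym; trans; cong; subst; ≢-sym)
open import Relation.Unary using (Pred; Decidable)
open import Function using (id; _∘_)
open import Function.Definitions using (Injective)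

X≢Y : X ≢ Y
X≢Y ()

patOf-sym : ∀ {k} (es : List (PEdge k)) u v → patOf es u v ≡ patOf es v u
patOf-sym [] u v = refl
patOf-sym ((a ─ b ∶ p) ∷ es) u v with a ≟ᶠ u | b ≟ᶠ v | a ≟ᶠ v | b ≟ᶠ u
... | yes _ | yes _ | yes _ | yes _ = refl
... | yes _ | yes _ | yes _ | no _  = refl
... | yes _ | yes _ | no _  | _     = refl
... | yes _ | no _  | yes _ | yes _ = refl
... | yes _ | no _  | yes _ | no _  = patOf-sym es u v
... | yes _ | no _  | no _  | _     = patOf-sym es u v
... | no _  | _     | yes _ | yes _ = refl
... | no _  | _     | yes _ | no _  = patOf-sym es u v
... | no _  | _     | no _  | _     = patOf-sym es u v

nonEdge? : (p : Pat) → Dec (p ≡ nonEdge)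
nonEdge? nonEdge = yes refl
nonEdge? negEdge = no λ ()
nonEdge? anyEdge = no λ ()

Independent : ∀ {k m} → List (PEdge k) → (Fin m → Fin k) → Set
Independent es f = ∀ i i′ → patOf es (f i) (f i′) ≡ nonEdge

independent? : ∀ {k m} (es : List (PEdge k)) (f : Fin m → Fin k) → Dec (Independent es f)
independent? es f = all? λ i → all? λ i′ → nonEdge? (patOf es (f i) (f i′))

record BipartitePattern (a b : ℕ) (es : List (PEdge (a + b))) : Set where
  constructor bipartitePattern
  field
    independentˡ : Independent es (_↑ˡ b)
    independentʳ : Independent es (a ↑ʳ_)

bipartitePattern? : ∀ a b (es : List (PEdge (a + b))) → Dec (BipartitePattern a b es)
bipartitePattern? a b es =
  map′ (λ (l , r) → bipartitePattern l r) (λ (bipartitePattern l r) → l , r)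
       (independent? es (_↑ˡ b) ×-dec independent? es (a ↑ʳ_))

data Part (a b : ℕ) : Fin (a + b) → Set where
  left  : ∀ i → Part a b (i ↑ˡ b)
  right : ∀ j → Part a b (a ↑ʳ j)

part : ∀ a {b} (u : Fin (a + b)) → Part a b u
part ℕ.zero u = right u
part (ℕ.suc a) zero = left zero
part (ℕ.suc a) (suc u) with part a u
... | left i  = left (suc i)
... | right j = right j

F3-bipartite : BipartitePattern 2 4 F3pat
F3-bipartite = from-yes (bipartitePattern? 2 4 F3pat)

F4-bipartite : BipartitePattern 3 3 F4pat
F4-bipartite = from-yes (bipartitePattern? 3 3 F4pat)

F5-bipartite : BipartitePattern 3 3 F5pat
F5-bipartite = from-yes (bipartitePattern? 3 3 F5pat)

F6-bipartite : BipartitePattern 4 4 F6pat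
F6-bipartite = from-yes (bipartitePattern? 4 4 F6pat)

greatest : ∀ {m p} {P : Pred (Fin m) p} → Decidable P → ∃ P → ∃ λ i → P i × (∀ j → P j → j ≤ᶠ i)
greatest {ℕ.suc m} P? _ with any? (P? ∘ suc)
... | yes ∃P∘suc with greatest (P? ∘ suc) ∃P∘suc
...   | k , pₖ , k-greatest = suc k , pₖ , λ { zero _ → z≤n ; (suc j) pⱼ → s≤s (k-greatest j pⱼ) }
greatest {ℕ.suc m} P? (zero , p₀) | no ¬∃P∘suc =
  zero , p₀ , λ { zero _ → z≤n ; (suc j) pⱼ → ⊥-elim (¬∃P∘suc (j , pⱼ)) }
greatest {ℕ.suc m} P? (suc i , pᵢ) | no ¬∃P∘suc = ⊥-elim (¬∃P∘suc (i , pᵢ))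

module SignedBigraphProperties {n} (B : SignedBigraph n) where
  G : SignedGraph n
  G = graph B

  adj? : ∀ u v → Dec (Adj G u v)
  adj? u v with e G u v
  ... | just s  = yes (s , refl)
  ... | nothing = no λ ()

  negative? : ∀ u v → Dec (e G u v ≡ just neg)
  negative? u v with e G u v
  ... | just neg = yes refl
  ... | just pos = no λ ()
  ... | nothing  = no λ ()

  match-sym : ∀ p {u v} → Match p (e G u v) → Match p (e G v u)
  match-sym p {u} {v} = subst (Match p) (symmetric G u v)

  adj-sym : ∀ {u v} → Adj G u v → Adj G v u
  adj-sym = match-sym anyEdge

  ¬adj⇒nothing : ∀ {u v} → ¬ Adj G u v → e G u v ≡ nothing
  ¬adj⇒nothing {u} {v} ¬a with e G u v
  ... | nothing = refl
  ... | just s  = ⊥-elim (¬a (s , refl))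

  nothing⇒¬adj : ∀ {u v} → e G u v ≡ nothing → ¬ Adj G u v
  nothing⇒¬adj u≁v (s , u~v) with trans (sym u≁v) u~v
  ... | ()

  sameSide⇒nothing : ∀ {u v} → side B u ≡ side B v → e G u v ≡ nothing
  sameSide⇒nothing {u} {v} same = ¬adj⇒nothing λ u~v → bipartite B u v u~v same

  X-neighbour : ∀ {u v} → side B u ≡ X → Adj G u v → side B v ≡ Y
  X-neighbour {u} {v} su u~v with side B v in sv
  ... | X = ⊥-elim (bipartite B u v u~v (trans su (sym sv)))
  ... | Y = refl

  Y-neighbour : ∀ {u v} → side B u ≡ Y → Adj G u v → side B v ≡ X
  Y-neighbour {u} {v} su u~v with side B v in sv
  ... | X = refl
  ... | Y = ⊥-elim (bipartite B u v u~v (trans su (sym sv)))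

  neighbours-≢ : ∀ {u v w} → Adj G w u → ¬ Adj G w v → u ≢ v
  neighbours-≢ w~u w≁v refl = w≁v w~u

  separated-≢ : ∀ {u v w} → Adj G u w → ¬ Adj G v w → u ≢ v
  separated-≢ u~w v≁w refl = v≁w u~w

  _⊆ᴺ_ : Fin n → Fin n → Set
  u ⊆ᴺ w = ∀ z → Adj G u z → Adj G w z

  record MinimalNeighbour (y : Fin n) : Set where
    field
      vertex  : Fin n
      adj     : Adj G vertex y
      minimal : ∀ w → Adj G w y → vertex ⊆ᴺ w

  InducesBiclique : Fin n → Fin n → Set
  InducesBiclique u v = ∀ w z → InN2 G u v w → InN2 G u v z →
    side B w ≡ X → side B z ≡ Y → Adj G w z

  via-second : ∀ {u v w} → side B u ≡ side B w → Adj G u w ⊎ Adj G v w → Adj G v w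
  via-second {u} {v} {w} same (inj₁ u~w) = ⊥-elim (bipartite B u w u~w same)
  via-second same (inj₂ v~w) = v~w

  via-first : ∀ {u v w} → side B v ≡ side B w → Adj G u w ⊎ Adj G v w → Adj G u w
  via-first same (inj₁ u~w) = u~w
  via-first {u} {v} {w} same (inj₂ v~w) = ⊥-elim (bipartite B v w v~w same)

  minimal⇒biclique : ∀ {u v} → side B u ≡ X → side B v ≡ Y →
    (∀ w → Adj G w v → u ⊆ᴺ w) → InducesBiclique u v
  minimal⇒biclique su sv minimal w z (w∈ , _) (z∈ , _) sw sz =
    minimal w (adj-sym (via-second (trans su (sym sw)) w∈)) z (via-first (trans sv (sym sz)) z∈)

  inN2? : ∀ u v w → Dec (InN2 G u v w)
  inN2? u v w = (adj? u w ⊎-dec adj? v w) ×-dec (¬? (w ≟ᶠ u) ×-dec ¬? (w ≟ᶠ v))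

  negativeEdge-in-N2 : ∀ {u v} → InducesBiclique u v → ¬ SignedSimplicial B u v →
    Σ (Fin n) λ w → Σ (Fin n) λ z → InN2 G u v w × InN2 G u v z × e G w z ≡ just neg
  negativeEdge-in-N2 {u} {v} biclique ¬simplicial
    with any? (λ w → any? λ z → inN2? u v w ×-dec inN2? u v z ×-dec negative? w z)
  ... | yes (w , z , w∈ , z∈ , w─z⁻) = w , z , w∈ , z∈ , w─z⁻
  ... | no none = ⊥-elim (¬simplicial (biclique , positive))
    where
    positive : ∀ w z → InN2 G u v w → InN2 G u v z → Adj G w z → PositiveEdge G w z
    positive w z w∈ z∈ (pos , w─z) = w─z
    positive w z w∈ z∈ (neg , w─z) = ⊥-elim (none (w , z , w∈ , z∈ , w─z))

  record CrossNegativeEdge (u v : Fin n) : Set where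
    field
      x y      : Fin n
      x-side   : side B x ≡ X
      x~v      : Adj G x v
      x≢u      : x ≢ u
      u~y      : Adj G u y
      y≢v      : y ≢ v
      negative : e G x y ≡ just neg

  orient : ∀ {u v w z} → side B u ≡ X → side B v ≡ Y → InN2 G u v w → InN2 G u v z →
    side B w ≡ X → e G w z ≡ just neg → CrossNegativeEdge u v
  orient su sv (w∈ , w≢u , _) (z∈ , _ , z≢v) sw w─z⁻ = record
    { x = _ ; y = _ ; x-side = sw
    ; x~v = adj-sym (via-second (trans su (sym sw)) w∈) ; x≢u = w≢u
    ; u~y = via-first (trans sv (sym (X-neighbour sw (neg , w─z⁻)))) z∈ ; y≢v = z≢v
    ; negative = w─z⁻ }

  crossNegativeEdge : ∀ {u v} → side B u ≡ X → side B v ≡ Y →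
    (∀ w → Adj G w v → u ⊆ᴺ w) → ¬ SignedSimplicial B u v → CrossNegativeEdge u v
  crossNegativeEdge su sv minimal ¬simplicial
    with negativeEdge-in-N2 (minimal⇒biclique su sv minimal) ¬simplicial
  ... | w , z , w∈ , z∈ , w─z⁻ with side B w in sw
  ...   | X = orient su sv w∈ z∈ sw w─z⁻
  ...   | Y = orient su sv z∈ w∈ (Y-neighbour sw (neg , w─z⁻)) (match-sym negEdge w─z⁻)

  CrossMatch : ∀ {a b} → List (PEdge (a + b)) → Vec (Fin n) a → Vec (Fin n) b → Set
  CrossMatch {a} {b} es xs ys =
    ∀ i j → Match (patOf es (i ↑ˡ b) (a ↑ʳ j)) (e G (lookup xs i) (lookup ys j))

  inducesPattern-++ : ∀ {a b σ τ} {es : List (PEdge (a + b))} → BipartitePattern a b es → σ ≢ τ →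
    {xs : Vec (Fin n) a} {ys : Vec (Fin n) b} →
    All (λ v → side B v ≡ σ) xs → All (λ v → side B v ≡ τ) ys → Unique xs → Unique ys →
    CrossMatch es xs ys → InducesPattern G es (lookup (xs ++ ys))
  inducesPattern-++ {a} {b} {σ} {τ} {es} (bipartitePattern independentˡ independentʳ) σ≢τ {xs} {ys}
                    sides-xs sides-ys unique-xs unique-ys cross = injective , matches
    where
    g : Fin (a + b) → Fin n
    g = lookup (xs ++ ys)
    sideˡ : ∀ i → side B (g (i ↑ˡ b)) ≡ σ
    sideˡ i = trans (cong (side B) (lookup-++ˡ xs ys i)) (lookup⁺ sides-xs i)
    sideʳ : ∀ j → side B (g (a ↑ʳ j)) ≡ τ
    sideʳ j = trans (cong (side B) (lookup-++ʳ xs ys j)) (lookup⁺ sides-ys j)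
    parts-differ : ∀ i j → g (i ↑ˡ b) ≢ g (a ↑ʳ j)
    parts-differ i j eq = σ≢τ (trans (sym (sideˡ i)) (trans (cong (side B) eq) (sideʳ j)))

    injective : Injective _≡_ _≡_ g
    injective {u} {v} eq with part a u | part a v
    ... | left i  | left i′  = cong (_↑ˡ b) (lookup-injective unique-xs i i′
            (trans (sym (lookup-++ˡ xs ys i)) (trans eq (lookup-++ˡ xs ys i′))))
    ... | left i  | right j  = ⊥-elim (parts-differ i j eq)
    ... | right j | left i   = ⊥-elim (parts-differ i j (sym eq))
    ... | right j | right j′ = cong (a ↑ʳ_) (lookup-injective unique-ys j j′
            (trans (sym (lookup-++ʳ xs ys j)) (trans eq (lookup-++ʳ xs ys j′))))

    matches : ∀ u v → Match (patOf es u v) (e G (g u) (g v))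
    matches u v with part a u | part a v
    ... | left i  | left i′  rewrite independentˡ i i′ = sameSide⇒nothing (trans (sideˡ i) (sym (sideˡ i′)))
    ... | left i  | right j  rewrite lookup-++ˡ xs ys i | lookup-++ʳ xs ys j = cross i j
    ... | right j | left i   rewrite patOf-sym es (a ↑ʳ j) (i ↑ˡ b) | lookup-++ˡ xs ys i | lookup-++ʳ xs ys j =
            match-sym (patOf es (i ↑ˡ b) (a ↑ʳ j)) (cross i j)
    ... | right j | right j′ rewrite independentʳ j j′ = sameSide⇒nothing (trans (sideʳ j) (sym (sideʳ j′)))

  containsF3 : ∀ {σ τ} (a b p q r s : Fin n) → σ ≢ τ →
    All (λ v → side B v ≡ σ) (a ∷ b ∷ []) → All (λ v → side B v ≡ τ) (p ∷ q ∷ r ∷ s ∷ []) →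
    Unique (a ∷ b ∷ []) → Unique (p ∷ q ∷ r ∷ s ∷ []) →
    e G a p ≡ just neg → e G a q ≡ just neg → Adj G a r → Adj G a s →
    Adj G b p → Adj G b q → e G b r ≡ just neg → e G b s ≡ just neg →
    ContainsF3456 G
  containsF3 a b p q r s σ≢τ sides₁ sides₂ unique₁ unique₂ a─p a─q a─r a─s b─p b─q b─r b─s =
    inj₁ (_ , inducesPattern-++ F3-bipartite σ≢τ sides₁ sides₂ unique₁ unique₂ cross)
    where
    cross : CrossMatch F3pat (a ∷ b ∷ []) (p ∷ q ∷ r ∷ s ∷ [])
    cross 0F 0F = a─p
    cross 0F 1F = a─q
    cross 0F 2F = a─r
    cross 0F 3F = a─s
    cross 1F 0F = b─p
    cross 1F 1F = b─q
    cross 1F 2F = b─r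
    cross 1F 3F = b─s

  containsF4 : ∀ {σ τ} (a b c p q r : Fin n) → σ ≢ τ →
    All (λ v → side B v ≡ σ) (a ∷ b ∷ c ∷ []) → All (λ v → side B v ≡ τ) (p ∷ q ∷ r ∷ []) →
    Unique (a ∷ b ∷ c ∷ []) → Unique (p ∷ q ∷ r ∷ []) →
    e G a p ≡ just neg → Adj G a q → Adj G a r →
    Adj G b p → e G b q ≡ just neg → Adj G b r →
    Adj G c p → Adj G c q → e G c r ≡ just neg →
    ContainsF3456 G
  containsF4 a b c p q r σ≢τ sides₁ sides₂ unique₁ unique₂ a─p a─q a─r b─p b─q b─r c─p c─q c─r =
    inj₂ (inj₁ (_ , inducesPattern-++ F4-bipartite σ≢τ sides₁ sides₂ unique₁ unique₂ cross))
    where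
    cross : CrossMatch F4pat (a ∷ b ∷ c ∷ []) (p ∷ q ∷ r ∷ [])
    cross 0F 0F = a─p
    cross 0F 1F = a─q
    cross 0F 2F = a─r
    cross 1F 0F = b─p
    cross 1F 1F = b─q
    cross 1F 2F = b─r
    cross 2F 0F = c─p
    cross 2F 1F = c─q
    cross 2F 2F = c─r

  containsF5 : ∀ {σ τ} (a b c p q r : Fin n) → σ ≢ τ →
    All (λ v → side B v ≡ σ) (a ∷ b ∷ c ∷ []) → All (λ v → side B v ≡ τ) (p ∷ q ∷ r ∷ []) →
    Unique (a ∷ b ∷ c ∷ []) → Unique (p ∷ q ∷ r ∷ []) →
    Adj G a p → Adj G a q → ¬ Adj G a r →
    e G b p ≡ just neg → Adj G b q → Adj G b r →
    Adj G c p → e G c q ≡ just neg → Adj G c r →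
    ContainsF3456 G
  containsF5 a b c p q r σ≢τ sides₁ sides₂ unique₁ unique₂ a─p a─q a≁r b─p b─q b─r c─p c─q c─r =
    inj₂ (inj₂ (inj₁ (_ , inducesPattern-++ F5-bipartite σ≢τ sides₁ sides₂ unique₁ unique₂ cross)))
    where
    cross : CrossMatch F5pat (a ∷ b ∷ c ∷ []) (p ∷ q ∷ r ∷ [])
    cross 0F 0F = a─p
    cross 0F 1F = a─q
    cross 0F 2F = ¬adj⇒nothing a≁r
    cross 1F 0F = b─p
    cross 1F 1F = b─q
    cross 1F 2F = b─r
    cross 2F 0F = c─p
    cross 2F 1F = c─q
    cross 2F 2F = c─r

  containsF6 : ∀ {σ τ} (a b c d p q r s : Fin n) → σ ≢ τ →
    All (λ v → side B v ≡ σ) (a ∷ b ∷ c ∷ d ∷ []) → All (λ v → side B v ≡ τ) (p ∷ q ∷ r ∷ s ∷ []) →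
    Unique (a ∷ b ∷ c ∷ d ∷ []) → Unique (p ∷ q ∷ r ∷ s ∷ []) →
    e G a p ≡ just neg → Adj G a q → ¬ Adj G a r → ¬ Adj G a s →
    e G b p ≡ just neg → Adj G b q → ¬ Adj G b r → ¬ Adj G b s →
    Adj G c p → e G c q ≡ just neg → Adj G c r → Adj G c s →
    Adj G d p → Adj G d q → e G d r ≡ just neg → e G d s ≡ just neg →
    ContainsF3456 G
  containsF6 a b c d p q r s σ≢τ sides₁ sides₂ unique₁ unique₂
             a─p a─q a≁r a≁s b─p b─q b≁r b≁s c─p c─q c─r c─s d─p d─q d─r d─s =
    inj₂ (inj₂ (inj₂ (_ , inducesPattern-++ F6-bipartite σ≢τ sides₁ sides₂ unique₁ unique₂ cross)))
    where
    cross : CrossMatch F6pat (a ∷ b ∷ c ∷ d ∷ []) (p ∷ q ∷ r ∷ s ∷ [])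
    cross 0F 0F = a─p
    cross 0F 1F = a─q
    cross 0F 2F = ¬adj⇒nothing a≁r
    cross 0F 3F = ¬adj⇒nothing a≁s
    cross 1F 0F = b─p
    cross 1F 1F = b─q
    cross 1F 2F = ¬adj⇒nothing b≁r
    cross 1F 3F = ¬adj⇒nothing b≁s
    cross 2F 0F = c─p
    cross 2F 1F = c─q
    cross 2F 2F = c─r
    cross 2F 3F = c─s
    cross 3F 0F = d─p
    cross 3F 1F = d─q
    cross 3F 2F = d─r
    cross 3F 3F = d─s

module CanonicalOrderingProperties {n α β} (B : SignedBigraph n)
  {ox : Fin α → Fin n} {oy : Fin β → Fin n} (canonical : CanonicalOrdering B ox oy) where
  open SignedBigraphProperties B

  ox-onto : ∀ v → side B v ≡ X → Σ (Fin α) λ i → ox i ≡ v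
  ox-onto = proj₂ (proj₂ (proj₁ canonical))

  oy-onto : ∀ v → side B v ≡ Y → Σ (Fin β) λ i → oy i ≡ v
  oy-onto = proj₂ (proj₂ (proj₁ (proj₂ canonical)))

  ox-antitone : ∀ i j → i ≤ᶠ j → ox j ⊆ᴺ ox i
  ox-antitone = proj₁ (proj₂ (proj₂ canonical))

  oy-monotone : ∀ i j → i ≤ᶠ j → oy i ⊆ᴺ oy j
  oy-monotone = proj₂ (proj₂ (proj₂ canonical))

  adj-y₁⇒adj-Y : (β>0 : 0 < β) → ∀ {x} → Adj G x (oy (fromℕ< β>0)) → ∀ y → side B y ≡ Y → Adj G x y
  adj-y₁⇒adj-Y β>0 {x} x~y₁ y sy with oy-onto y sy
  ... | t , refl = adj-sym (oy-monotone (fromℕ< β>0) t y₁≤t x (adj-sym x~y₁))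
    where
    y₁≤t : fromℕ< β>0 ≤ᶠ t
    y₁≤t = subst (ℕ._≤ toℕ t) (sym (toℕ-fromℕ< β>0)) z≤n

  minimalNeighbour : ∀ {x y} → side B y ≡ Y → Adj G x y → MinimalNeighbour y
  minimalNeighbour {x} {y} sy x~y with ox-onto x (Y-neighbour sy (adj-sym x~y))
  ... | i , refl with greatest (λ j → adj? (ox j) y) (i , x~y)
  ...   | last , last~y , last-greatest = record
    { vertex = ox last ; adj = last~y ; minimal = minimal }
    where
    minimal : ∀ w → Adj G w y → ox last ⊆ᴺ w
    minimal w w~y with ox-onto w (Y-neighbour sy (adj-sym w~y))
    ... | t , refl = ox-antitone t last (last-greatest t w~y)

module Configuration {n α β} (B : SignedBigraph n) (ox : Fin α → Fin n) (oy : Fin β → Fin n)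
  (canonical : CanonicalOrdering B ox oy) (xi xj xk yl yq yr : Fin n)
  (sxi : side B xi ≡ X) (sxj : side B xj ≡ X)
  (syl : side B yl ≡ Y) (syq : side B yq ≡ Y) (syr : side B yr ≡ Y)
  (β>0 : 0 < β) (xi~y₁ : Adj (graph B) xi (oy (fromℕ< β>0))) (xj~y₁ : Adj (graph B) xj (oy (fromℕ< β>0)))
  (config : InducesPattern (graph B) ConfigPat (six xi xj xk yl yq yr))
  (¬simplicial : ∀ u v → Adj (graph B) u v → ¬ SignedSimplicial B u v) where
  open SignedBigraphProperties B
  open CanonicalOrderingProperties B canonical

  xi─yl : e G xi yl ≡ just neg
  xi─yl = proj₂ config 0F 3F
  xi─yq : e G xi yq ≡ just neg
  xi─yq = proj₂ config 0F 4F
  xi─yr : Adj G xi yr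
  xi─yr = proj₂ config 0F 5F
  xj─yl : Adj G xj yl
  xj─yl = proj₂ config 1F 3F
  xj─yq : Adj G xj yq
  xj─yq = proj₂ config 1F 4F
  xj─yr : e G xj yr ≡ just neg
  xj─yr = proj₂ config 1F 5F
  xk─yr : Adj G xk yr
  xk─yr = proj₂ config 2F 5F
  xk≁yl : ¬ Adj G xk yl
  xk≁yl = nothing⇒¬adj (proj₂ config 2F 3F)
  xk≁yq : ¬ Adj G xk yq
  xk≁yq = nothing⇒¬adj (proj₂ config 2F 4F)

  config-≢ : ∀ u v → u ≢ v → six xi xj xk yl yq yr u ≢ six xi xj xk yl yq yr v
  config-≢ u v u≢v = u≢v ∘ proj₁ config

  xi≢xj : xi ≢ xj
  xi≢xj = config-≢ 0F 1F λ ()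
  yl≢yq : yl ≢ yq
  yl≢yq = config-≢ 3F 4F λ ()
  yl≢yr : yl ≢ yr
  yl≢yr = config-≢ 3F 5F λ ()
  yq≢yr : yq ≢ yr
  yq≢yr = config-≢ 4F 5F λ ()

  xi~Y : ∀ y → side B y ≡ Y → Adj G xi y
  xi~Y = adj-y₁⇒adj-Y β>0 xi~y₁
  xj~Y : ∀ y → side B y ≡ Y → Adj G xj y
  xj~Y = adj-y₁⇒adj-Y β>0 xj~y₁

  open MinimalNeighbour (minimalNeighbour syr xk─yr)
    renaming (vertex to xs; adj to xs─yr; minimal to xs-minimal)

  xs-side : side B xs ≡ X
  xs-side = Y-neighbour syr (adj-sym xs─yr)
  xs≁yl : ¬ Adj G xs yl
  xs≁yl = xk≁yl ∘ xs-minimal xk xk─yr yl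
  xs≁yq : ¬ Adj G xs yq
  xs≁yq = xk≁yq ∘ xs-minimal xk xk─yr yq
  xs≢xi : xs ≢ xi
  xs≢xi = ≢-sym (separated-≢ (neg , xi─yl) xs≁yl)
  xs≢xj : xs ≢ xj
  xs≢xj = ≢-sym (separated-≢ xj─yl xs≁yl)

  negativeEdgeBelow : ∀ {u} → side B u ≡ X → Adj G u yr → u ⊆ᴺ xs → CrossNegativeEdge u yr
  negativeEdgeBelow su u~yr u⊆xs = crossNegativeEdge su syr
    (λ w w~yr z u~z → xs-minimal w w~yr z (u⊆xs z u~z)) (¬simplicial _ yr u~yr)

  Outside : Fin n → Set
  Outside x = x ≢ xi × x ≢ xj × ¬ Adj G x yl × ¬ Adj G x yq

  module Classification {u} (u⊆xs : u ⊆ᴺ xs) (N : CrossNegativeEdge u yr) where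
    open CrossNegativeEdge N

    xs~y : Adj G xs y
    xs~y = u⊆xs y u~y
    sy : side B y ≡ Y
    sy = X-neighbour xs-side xs~y
    yl≢y : yl ≢ y
    yl≢y = ≢-sym (neighbours-≢ xs~y xs≁yl)
    yq≢y : yq ≢ y
    yq≢y = ≢-sym (neighbours-≢ xs~y xs≁yq)
    yr≢y : yr ≢ y
    yr≢y = ≢-sym y≢v

    viaF4 : ∀ {yp} → side B yp ≡ Y → yp ≢ yr → yp ≢ y → e G xi yp ≡ just neg → Adj G xj yp →
      x ≢ xi → x ≢ xj → Adj G x yp → ContainsF3456 G
    viaF4 {yp} syp yp≢yr yp≢y xi─yp xj─yp x≢xi x≢xj x~yp = containsF4 xi xj x yp yr y X≢Y
      (sxi ∷ sxj ∷ x-side ∷ []) (syp ∷ syr ∷ sy ∷ [])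
      ((xi≢xj ∷ ≢-sym x≢xi ∷ []) ∷ (≢-sym x≢xj ∷ []) ∷ [] ∷ [])
      ((yp≢yr ∷ yp≢y ∷ []) ∷ (yr≢y ∷ []) ∷ [] ∷ [])
      xi─yp xi─yr (xi~Y y sy) xj─yp xj─yr (xj~Y y sy) x~yp x~v negative

    classify : ContainsF3456 G ⊎ Outside x
    classify with x ≟ᶠ xj | x ≟ᶠ xi | adj? x yl | adj? x yq
    ... | yes refl | _ | _ | _ = inj₁ (containsF3 xi xj yl yq yr y X≢Y
          (sxi ∷ sxj ∷ []) (syl ∷ syq ∷ syr ∷ sy ∷ [])
          ((xi≢xj ∷ []) ∷ [] ∷ [])
          ((yl≢yq ∷ yl≢yr ∷ yl≢y ∷ []) ∷ (yq≢yr ∷ yq≢y ∷ []) ∷ (yr≢y ∷ []) ∷ [] ∷ [])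
          xi─yl xi─yq xi─yr (xi~Y y sy) xj─yl xj─yq xj─yr negative)
    ... | no _ | yes refl | _ | _ = inj₁ (containsF5 xs xj xi yr y yl X≢Y
          (xs-side ∷ sxj ∷ sxi ∷ []) (syr ∷ sy ∷ syl ∷ [])
          ((xs≢xj ∷ xs≢xi ∷ []) ∷ (≢-sym xi≢xj ∷ []) ∷ [] ∷ [])
          ((yr≢y ∷ ≢-sym yl≢yr ∷ []) ∷ (≢-sym yl≢y ∷ []) ∷ [] ∷ [])
          xs─yr xs~y xs≁yl xj─yr (xj~Y y sy) xj─yl xi─yr negative (neg , xi─yl))
    ... | no x≢xj | no x≢xi | yes x~yl | _ =
          inj₁ (viaF4 syl yl≢yr yl≢y xi─yl xj─yl x≢xi x≢xj x~yl)
    ... | no x≢xj | no x≢xi | no _ | yes x~yq =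
          inj₁ (viaF4 syq yq≢yr yq≢y xi─yq xj─yq x≢xi x≢xj x~yq)
    ... | no x≢xj | no x≢xi | no x≁yl | no x≁yq = inj₂ (x≢xi , x≢xj , x≁yl , x≁yq)

  open Classification public using (classify)

  firstEdge : CrossNegativeEdge xs yr
  firstEdge = negativeEdgeBelow xs-side xs─yr (λ _ → id)

  module FromFirstEdge (N₁ : CrossNegativeEdge xs yr) where
    open CrossNegativeEdge N₁
      renaming (x to x′; y to y′; x-side to x′-side; x~v to x′─yr; x≢u to x′≢xs; u~y to xs─y′;
                y≢v to y′≢yr; negative to x′─y′)

    y′-side : side B y′ ≡ Y
    y′-side = X-neighbour xs-side xs─y′

    module FromSecondEdge (N₂ : CrossNegativeEdge x′ yr) where
      open CrossNegativeEdge N₂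
        renaming (x to x″; y to y″; x-side to x″-side; x~v to x″─yr; x≢u to x″≢x′; u~y to x′─y″;
                  y≢v to y″≢yr; negative to x″─y″)

      bothOutside : Outside x′ → Outside x″ → ContainsF3456 G
      bothOutside (x′≢xi , x′≢xj , x′≁yl , x′≁yq) (x″≢xi , x″≢xj , x″≁yl , x″≁yq) with y″ ≟ᶠ y′
      ... | yes refl = containsF6 yl yq yr y′ xi xj x′ x″ (λ ())
            (syl ∷ syq ∷ syr ∷ y′-side ∷ []) (sxi ∷ sxj ∷ x′-side ∷ x″-side ∷ [])
            ((yl≢yq ∷ yl≢yr ∷ yl≢y′ ∷ []) ∷ (yq≢yr ∷ yq≢y′ ∷ []) ∷ (≢-sym y′≢yr ∷ []) ∷ [] ∷ [])
            ((xi≢xj ∷ ≢-sym x′≢xi ∷ ≢-sym x″≢xi ∷ []) ∷ (≢-sym x′≢xj ∷ ≢-sym x″≢xj ∷ []) ∷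
               (≢-sym x″≢x′ ∷ []) ∷ [] ∷ [])
            (match-sym negEdge xi─yl) (adj-sym xj─yl) (x′≁yl ∘ adj-sym) (x″≁yl ∘ adj-sym)
            (match-sym negEdge xi─yq) (adj-sym xj─yq) (x′≁yq ∘ adj-sym) (x″≁yq ∘ adj-sym)
            (adj-sym xi─yr) (match-sym negEdge xj─yr) (adj-sym x′─yr) (adj-sym x″─yr)
            (adj-sym (xi~Y y′ y′-side)) (adj-sym (xj~Y y′ y′-side)) (match-sym negEdge x′─y′)
            (match-sym negEdge x″─y″)
        where
        yl≢y′ : yl ≢ y′
        yl≢y′ = ≢-sym (neighbours-≢ xs─y′ xs≁yl)
        yq≢y′ : yq ≢ y′
        yq≢y′ = ≢-sym (neighbours-≢ xs─y′ xs≁yq)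
      ... | no y″≢y′ = containsF4 xj x′ x″ yr y′ y″ X≢Y
            (sxj ∷ x′-side ∷ x″-side ∷ []) (syr ∷ y′-side ∷ y″-side ∷ [])
            ((≢-sym x′≢xj ∷ ≢-sym x″≢xj ∷ []) ∷ (≢-sym x″≢x′ ∷ []) ∷ [] ∷ [])
            ((≢-sym y′≢yr ∷ ≢-sym y″≢yr ∷ []) ∷ (≢-sym y″≢y′ ∷ []) ∷ [] ∷ [])
            xj─yr (xj~Y y′ y′-side) (xj~Y y″ y″-side)
            x′─yr x′─y′ x′─y″
            x″─yr (xs-minimal x″ x″─yr y′ xs─y′) x″─y″
        where
        y″-side : side B y″ ≡ Y
        y″-side = X-neighbour x′-side x′─y″

    open FromSecondEdge using (bothOutside)

    afterFirstEdge : Outside x′ → ContainsF3456 G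
    afterFirstEdge outside′@(_ , x′≢xj , _) with any? (λ z → adj? x′ z ×-dec ¬? (adj? xs z))
    ... | yes (z , x′─z , xs≁z) = containsF5 xs xj x′ yr y′ z X≢Y
            (xs-side ∷ sxj ∷ x′-side ∷ []) (syr ∷ y′-side ∷ z-side ∷ [])
            ((xs≢xj ∷ ≢-sym x′≢xs ∷ []) ∷ (≢-sym x′≢xj ∷ []) ∷ [] ∷ [])
            ((≢-sym y′≢yr ∷ neighbours-≢ xs─yr xs≁z ∷ []) ∷ (neighbours-≢ xs─y′ xs≁z ∷ []) ∷ [] ∷ [])
            xs─yr xs─y′ xs≁z xj─yr (xj~Y y′ y′-side) (xj~Y z z-side) x′─yr x′─y′ x′─z
      where
      z-side : side B z ≡ Y
      z-side = X-neighbour x′-side x′─z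
    ... | no ∄ = [ id , bothOutside N₂ outside′ ]′ (classify x′⊆xs N₂)
      where
      x′⊆xs : x′ ⊆ᴺ xs
      x′⊆xs z x′─z with adj? xs z
      ... | yes xs─z = xs─z
      ... | no xs≁z = ⊥-elim (∄ (z , x′─z , xs≁z))
      N₂ : CrossNegativeEdge x′ yr
      N₂ = negativeEdgeBelow x′-side x′─yr x′⊆xs

  open FromFirstEdge public using (afterFirstEdge)

-- Non-separability and the absence of isolated vertices only serve to make a canonical ordering
-- exist, and x_k ∈ X follows from x_k ~ y_r.
lemma3p4 : ∀ {n α β} (B : SignedBigraph n) (ox : Fin α → Fin n) (oy : Fin β → Fin n) →
    NonSeparable (graph B) → NoIsolatedVertices (graph B) →
    CanonicalOrdering B ox oy →
    (xi xj xk yl yq yr : Fin n) →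
    side B xi ≡ X → side B xj ≡ X → side B xk ≡ X →
    side B yl ≡ Y → side B yq ≡ Y → side B yr ≡ Y →
    (β>0 : 0 < β) →
    Adj (graph B) xi (oy (fromℕ< β>0)) → Adj (graph B) xj (oy (fromℕ< β>0)) →
    InducesPattern (graph B) ConfigPat (six xi xj xk yl yq yr) →
    (∀ u v → Adj (graph B) u v → ¬ SignedSimplicial B u v) →
    ContainsF3456 (graph B)
lemma3p4 B ox oy _ _ canonical xi xj xk yl yq yr sxi sxj _ syl syq syr β>0 xi~y₁ xj~y₁ config ¬simplicial =
  [ id , afterFirstEdge firstEdge ]′ (classify (λ _ → id) firstEdge)
  where
  open Configuration B ox oy canonical xi xj xk yl yq yr sxi sxj syl syq syr β>0 xi~y₁ xj~y₁ config ¬simplicial
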